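{- Let $P\in\mathbb{Z}[x_1,\ldots,x_n]$ be such that $\tilde P$ is nonzero and splits as a product of linear factors over $\mathbb{Z}$, and suppose $P$ satisfies the minimal Rado condition. Then there exist a root $a\in\mathbb{Z}$ of $\tilde P$ and a minimal Rado set $J$ of $P^{(a)}$ such that the equation $$\sum_{\alpha\in J}\frac1{\alpha!}\frac{\partial^\alpha P}{\partial x^\alpha}(\boldsymbol a)\,w^{|\alpha|}=0$$ has a nonzero solution in $\mathbb{Z}/p\mathbb{Z}$ for infinitely many primes $p$. Moreover, if this $J$ is homogeneous, then $\sum_{\alpha\in J}\frac1{\alpha!}\frac{\partial^\alpha P}{\partial x^\alpha}(\boldsymbol a)=0$.
   Context: $\mathbb{N}=\{1,2,\ldots\}$, $\mathbb{N}_0=\mathbb{N}\cup\{0\}$. For $P=\sum_\alpha c_\alpha x^\alpha\in\mathbb{Z}[x_1,\ldots,x_n]$: $\mathrm{Supp}(P)=\{\alpha\in\mathbb{N}_0^n:c_\alpha\neq0\}$; $|\alpha|=\sum\alpha_i$; $\alpha!=\prod\alpha_i!$; for $r\in\mathbb{Z}$, $\boldsymbol r=(r,\ldots,r)$ and $P^{(r)}(x)=P(x_1+r,\ldots,x_n+r)$ (its coefficient of $x^\alpha$ is $\frac1{\alpha!}\frac{\partial^\alpha P}{\partial x^\alpha}(\boldsymbol r)$); $\tilde P(w)=P(w,\ldots,w)$. A set $J$ of indices is homogeneous if all $\alpha\in J$ have the same degree $|\alpha|$. A positive linear map is $\phi(\alpha)=t_1\alpha_1+\cdots+t_n\alpha_n$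 with $t_i\in\mathbb{N}_0$; it is $c$-monochromatic (for a finite coloring $c$) if $\{t_1,\ldots,t_n\}$ is. If $M_0<\cdots<M_\ell$ enumerates $\phi(\mathrm{Supp}(P))$, the partition determined by $\phi$ is $(J_0,\ldots,J_\ell)$, $J_i=\{\alpha\in\mathrm{Supp}(P):\phi(\alpha)=M_i\}$. A Rado partition of $P$ is an ordered tuple $(J_0,\ldots,J_\ell)$ such that for every finite coloring $c$ of $\mathbb{N}_0$ there are infinitely many $c$-monochromatic positive linear maps determining it. A minimal Rado set for $P$ is a set $J$ such that $J=J_0$ for some Rado partition $(J_0,\ldots,J_\ell)$ of $P$. A minimal (lower) Rado functional of order $m$ for $P$ is a tuple $(J_0,\ldots,J_\ell,d_1,\ldots,d_m)$, $\ell\ge m$, $d_i\in\mathbb{N}$, such that for every finite coloring $c$ of $\mathbb{N}$ and every $k\in\mathbb{N}$ there are infinitely many $c$-monochromatic positive linear maps $\phi$ determining the partition $(J_0,\ldots,J_\ell)$ with $M_i-M_0=d_i$ ($1\le i\le m$) and $M_{m+1}-M_m\ge k$. $P$ satisfies the minimal Rado condition if for every prime $p$ there exist a root $a\in\mathbb{Z}$ of $\tilde P$ and a minimal Rado functional $(J_0,\ldots,J_\ell,d_1,\ldots,d_m)$ for $P^{(a)}$ such that, with $d_0:=0$, the equation $\sum_{i=0}^m p^{d_i}\sum_{\alpha\in J_i}\frac1{\alpha!}\frac{\partial^\alpha P}{\partial x^\alpha}(\boldsymbol a)w^{|\alpha|}=0$ has an invertible solution in the $p$-adic integers $\mathbb{Z}_p$.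 -}

module Defs where

open import Data.Nat as ℕ using (ℕ; zero; suc; _∸_; _≤_; _<_)
open import Data.Nat.Combinatorics using (_C_)
open import Data.Nat.Primality using (Prime)
open import Data.Integer as ℤ using (ℤ; +_; _-_)
open import Data.Integer.Divisibility using () renaming (_∣_ to _∣ℤ_)
open import Data.Fin using (Fin; zero; suc; toℕ; inject≤; fromℕ)
open import Data.Vec as Vec using (Vec; []; _∷_; replicate; zipWith; foldr; toList)
open import Data.Vec.Properties using (≡-dec)
open import Data.List as List using (List; []; _∷_; concatMap; map)
open import Data.List.Membership.Propositional using (_∈_; _∉_)
open import Data.List.Relation.Unary.Unique.Propositional using (Unique)
open import Data.Product using (Σ; ∃; ∃-syntax; _×_; _,_)
open import Relation.Binary.PropositionalEquality using (_≡_; _≢_)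
open import Relation.Nullary using (¬_; yes; no)
open import Function.Bundles using (_⇔_)

-- Repeated exponents are allowed; the actual coefficient of x^α is
-- 'coeff P α' (sum of the coefficients of all terms with exponent α).

sum : List ℤ → ℤ
sum = List.foldr ℤ._+_ (+ 0)

prodℤ : List ℤ → ℤ
prodℤ = List.foldr ℤ._*_ (+ 1)

Mono : ℕ → Set
Mono n = Vec ℕ n

Poly : ℕ → Set
Poly n = List (ℤ × Mono n)

coeff : ∀ {n} → Poly n → Mono n → ℤ
coeff [] α = + 0
coeff ((c , β) ∷ P) α with ≡-dec ℕ._≟_ β α
... | yes _ = c ℤ.+ coeff P α
... | no  _ = coeff P α

Supp : ∀ {n} → Poly n → Mono n → Set
Supp P α = coeff P α ≢ + 0

deg : ∀ {n} → Mono n → ℕ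
deg α = foldr _ ℕ._+_ 0 α

evalMono : ∀ {n} → Mono n → Vec ℤ n → ℤ
evalMono [] [] = + 1
evalMono (k ∷ α) (x ∷ xs) = (x ℤ.^ k) ℤ.* evalMono α xs

eval : ∀ {n} → Poly n → Vec ℤ n → ℤ
eval P x = sum (map (λ { (c , β) → c ℤ.* evalMono β x }) P)

tilde : ∀ {n} → Poly n → ℤ → ℤ
tilde P w = eval P (replicate _ w)

tildeCoeff : ∀ {n} → Poly n → ℕ → ℤ
tildeCoeff P d = sum (map (λ { (c , β) → c }) (List.filter (λ { (c , β) → deg β ℕ.≟ d }) P))

TildeNonzero : ∀ {n} → Poly n → Set
TildeNonzero P = ∃[ d ] tildeCoeff P d ≢ + 0

-- P̃ splits as a product of linear factors over ℤ:
-- P̃(w) = c · ∏ᵢ (bᵢ w + eᵢ) with bᵢ ≠ 0 (as functions on ℤ, which for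
-- polynomials over the infinite domain ℤ is equality of polynomials).
SplitsOverℤ : ∀ {n} → Poly n → Set
SplitsOverℤ P = ∃[ c ] ∃[ fs ]
  ((∀ {b e} → (b , e) ∈ fs → b ≢ + 0) ×
   (∀ w → tilde P w ≡ c ℤ.* prodℤ (map (λ { (b , e) → b ℤ.* w ℤ.+ e }) fs)))

box : ∀ {n} → Mono n → List (Mono n)
box [] = [] ∷ []
box (b ∷ β) = concatMap (λ g → map (g ∷_) (box β)) (List.upTo (suc b))

-- Taylor coefficient  ∏ᵢ C(βᵢ,γᵢ) r^(βᵢ-γᵢ)  of x^γ in (x + r)^β
binomFactor : ∀ {n} → Mono n → Mono n → ℤ → ℤ
binomFactor [] [] r = + 1
binomFactor (b ∷ β) (g ∷ γ) r = (+ (b C g)) ℤ.* (r ℤ.^ (b ∸ g)) ℤ.* binomFactor β γ r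

-- P^{(r)}(x) = P(x₁+r,…,xₙ+r), expanded termwise by the binomial theorem.
-- Its coefficient 'coeff (shift P r) α' is (1/α!) ∂^α P (r,…,r).
shift : ∀ {n} → Poly n → ℤ → Poly n
shift P r = concatMap (λ { (c , β) → map (λ γ → (c ℤ.* binomFactor β γ r , γ)) (box β) }) P

linMap : ∀ {n} → Vec ℕ n → Mono n → ℕ
linMap t α = foldr _ ℕ._+_ 0 (zipWith ℕ._*_ t α)

Monochromatic₀ : ∀ {n k} → (ℕ → Fin k) → Vec ℕ n → Set
Monochromatic₀ c t = ∀ i j → c (Vec.lookup t i) ≡ c (Vec.lookup t j)

-- For a coloring of ℕ = {1,2,…} (given as a function on ℕ₀ whose value at
-- 0 is irrelevant): all tᵢ ∈ ℕ and {t₁,…,tₙ} monochromatic.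
Monochromatic₁ : ∀ {n k} → (ℕ → Fin k) → Vec ℕ n → Set
Monochromatic₁ c t = (∀ i → 1 ≤ Vec.lookup t i) × Monochromatic₀ c t

-- A finite set of exponents is a duplicate-free list.
-- φ (given by t) determines the partition (J₀,…,J_ℓ) of Supp(P) with
-- values M₀ < ⋯ < M_ℓ enumerating φ(Supp P).
DeterminesWith : ∀ {n ℓ} → Poly n → Vec ℕ n → (Fin (suc ℓ) → List (Mono n))
               → (Fin (suc ℓ) → ℕ) → Set
DeterminesWith {n} {ℓ} P t J M =
  (∀ (i j : Fin (suc ℓ)) → toℕ i < toℕ j → M i < M j) ×
  (∀ i → ∃[ α ] (Supp P α × linMap t α ≡ M i)) ×
  (∀ α → Supp P α → ∃[ i ] linMap t α ≡ M i) ×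
  (∀ i → Unique (J i)) ×
  (∀ i α → (α ∈ J i) ⇔ (Supp P α × linMap t α ≡ M i))

Determines : ∀ {n ℓ} → Poly n → Vec ℕ n → (Fin (suc ℓ) → List (Mono n)) → Set
Determines {ℓ = ℓ} P t J = ∃[ M ] DeterminesWith P t J M

-- Rado partition: for every finite coloring of ℕ₀ there are infinitely
-- many monochromatic positive linear maps determining it
-- ("infinitely many" = not contained in any finite list).
RadoPartition : ∀ {n ℓ} → Poly n → (Fin (suc ℓ) → List (Mono n)) → Set
RadoPartition {n} P J =
  ∀ (k : ℕ) (c : ℕ → Fin k) (L : List (Vec ℕ n)) →
  ∃[ t ] (t ∉ L × Monochromatic₀ c t × Determines P t J)

MinimalRadoSet : ∀ {n} → Poly n → List (Mono n) → Set
MinimalRadoSet {n} P J =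
  ∃[ ℓ ] Σ (Fin (suc ℓ) → List (Mono n)) λ Js → RadoPartition P Js × Js zero ≡ J

dExt : ∀ {m} → (Fin m → ℕ) → Fin (suc m) → ℕ
dExt d zero = 0
dExt d (suc j) = d j

-- minimal Rado functional (J₀,…,J_ℓ,d₁,…,d_m) of order m, ℓ ≥ m.
-- The condition M_{m+1} - M_m ≥ k is imposed when ℓ > m (vacuous if ℓ = m).
MinimalRadoFunctional : ∀ {n ℓ m} → Poly n → (Fin (suc ℓ) → List (Mono n))
                      → (Fin m → ℕ) → m ≤ ℓ → Set
MinimalRadoFunctional {n} {ℓ} {m} P J d m≤ℓ =
  (∀ j → 1 ≤ d j) ×
  (∀ (k : ℕ) (c : ℕ → Fin k) (K : ℕ) (L : List (Vec ℕ n)) →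
   ∃[ t ] (t ∉ L × Monochromatic₁ c t × ∃[ M ] (DeterminesWith P t J M ×
     (∀ (j : Fin (suc m)) → M (inject≤ j (ℕ.s≤s m≤ℓ)) ≡ M zero ℕ.+ dExt d j) ×
     (∀ (i : Fin (suc ℓ)) → toℕ i ≡ suc m →
        K ≤ M i ∸ M (inject≤ (fromℕ m) (ℕ.s≤s m≤ℓ))))))

partPoly : ∀ {n} → Poly n → List (Mono n) → ℤ → ℤ
partPoly Q J w = sum (map (λ α → coeff Q α ℤ.* (w ℤ.^ deg α)) J)

radoEq : ∀ {n ℓ m} → ℕ → Poly n → (Fin (suc ℓ) → List (Mono n))
       → (Fin m → ℕ) → m ≤ ℓ → ℤ → ℤ
radoEq {m = m} p Q J d m≤ℓ w =
  sum (map (λ j → (+ p) ℤ.^ dExt d j ℤ.* partPoly Q (J (inject≤ j (ℕ.s≤s m≤ℓ))) w)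
           (List.allFin (suc m)))

-- A p-adic integer is a
-- compatible sequence (x_k)_{k≥1} with x_{k+1} ≡ x_k (mod p^k); F(x)=0 in
-- ℤ_p means F(x_k) ≡ 0 (mod p^k) for all k; x is a unit iff p ∤ x_1.
-- (x is indexed so that x k approximates mod p^(suc k).)
HasInvertibleZpRoot : ℕ → (ℤ → ℤ) → Set
HasInvertibleZpRoot p F =
  Σ (ℕ → ℤ) λ x →
    (∀ k → (+ p) ℤ.^ suc k ∣ℤ (x (suc k) - x k)) ×
    (∀ k → (+ p) ℤ.^ suc k ∣ℤ F (x k)) ×
    ¬ ((+ p) ∣ℤ x 0)

MinimalRadoCondition : ∀ {n} → Poly n → Set
MinimalRadoCondition {n} P =
  ∀ (p : ℕ) → Prime p →
  ∃[ a ] (tilde P a ≡ + 0 ×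
    ∃[ ℓ ] ∃[ m ] Σ (Fin (suc ℓ) → List (Mono n)) λ J → Σ (Fin m → ℕ) λ d →
      Σ (m ≤ ℓ) λ m≤ℓ →
        MinimalRadoFunctional (shift P a) J d m≤ℓ ×
        HasInvertibleZpRoot p (radoEq p (shift P a) J d m≤ℓ))

Homogeneous : ∀ {n} → List (Mono n) → Set
Homogeneous J = ∀ {α β} → α ∈ J → β ∈ J → deg α ≡ deg β

InfinitelyManyPrimesWithNonzeroRoot : (ℤ → ℤ) → Set
InfinitelyManyPrimesWithNonzeroRoot F =
  ∀ (N : ℕ) → ∃[ p ] (N < p × Prime p × ∃[ w ] (¬ ((+ p) ∣ℤ w) × (+ p) ∣ℤ F w))

-- Every root a of P̃ satisfies ∣a∣ ≤ Σ ∣eᵢ∣ for the splitting P̃ = c ∏ (bᵢ w + eᵢ), so the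
-- coefficients of all the shifts P^(a) at roots are bounded by some B. Take a prime p > B and
-- the data given by the minimal Rado condition at p. Modulo p the p-adic equation loses every
-- part Jᵢ with dᵢ ≥ 1, so F(w) = Σ_{α∈J₀} coeff(α) w^|α| has a root that is a unit mod p.
-- Writing F = wᵉ·G with G(0) ≠ 0, G cannot be a nonzero constant (its value is below p in
-- absolute value), so either F ≡ 0 or G is nonconstant, and then Schur's argument yields
-- infinitely many primes. If J₀ is homogeneous then F = S·wᵏ, and a root that is a unit
-- modulo a prime q > ∣S∣ forces S = 0.
module Submission where

open import Defs
open import Data.Nat using (ℕ)
open import Data.Integer using (ℤ; +_)
open import Data.List using (List; map)
open import Data.Product using (Σ; ∃-syntax; _×_)
open import Relation.Binary.PropositionalEquality using (_≡_)

open import Data.Nat as ℕ using (zero; suc; _≤_; _<_; z≤n; s≤s; _!; _⊔_; _∸_)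
open import Data.Nat.Combinatorics using (_C_)
import Data.Nat.Properties as ℕₚ
open import Data.Nat.Divisibility
  using (∣1⇒≡1; ∣⇒≤; m≤n⇒m!∣n!; m∣m*n; ∣-trans; _∣0) renaming (_∣_ to _∣ℕ_)
open import Data.Nat.Primality using (Prime; euclidsLemma; prime⇒nonTrivial)
open import Data.Nat.Primality.Factorisation using (factorise)
open import Data.Nat.ListAction using (product)
open import Data.Integer using (≢-nonZero; -[1+_]; 0ℤ; 1ℤ; _+_; _*_; _^_; -_; ∣_∣; _≟_)
import Data.Integer.Properties as ℤₚ
open import Data.Integer.Divisibility using () renaming (_∣_ to _∣ℤ_)
import Data.Integer.Divisibility.Signed as Signed
open import Data.Integer.Tactic.RingSolver using (solve-∀)
open import Algebra.Properties.CommutativeSemigroup ℤₚ.*-commutativeSemigroup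
  using () renaming (x∙yz≈y∙xz to i*[j*k]≡j*[i*k])
open import Algebra.Properties.CommutativeSemigroup ℕₚ.+-commutativeSemigroup
  using () renaming (x∙yz≈y∙xz to m+[n+o]≡n+[m+o])
open import Data.List using ([]; _∷_; _++_; tabulate)
import Data.List.Properties as List
open import Data.List.Relation.Unary.All as All using (All; []; _∷_)
import Data.List.Relation.Unary.All.Properties as All
open import Data.List.Relation.Unary.Any using (Any; here; there)
open import Data.List.Membership.Propositional using (_∈_)
open import Data.List.Relation.Unary.Unique.Propositional using (Unique)
open import Data.List.Relation.Unary.AllPairs using ([]; _∷_)
open import Data.Fin using (Fin; inject≤) renaming (zero to fzero; suc to fsuc)
open import Data.Vec using ([]; _∷_; replicate)
open import Data.Vec.Properties using (≡-dec)
open import Data.Product using (_,_; proj₁; proj₂; swap; map₂)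
open import Data.Sum using (_⊎_; inj₁; inj₂)
open import Relation.Nullary using (¬_; yes; no; contradiction)
open import Relation.Binary.PropositionalEquality
  using (refl; sym; trans; cong; cong₂; subst; subst₂; _≗_; _≢_; module ≡-Reasoning)
open import Function using (_∘_)
open import Data.Bool using (true; false; T)
open import Data.Unit using (tt)

private variable
  p : ℕ
  i j : ℤ

prime>1 : Prime p → 1 < p
prime>1 {p} p-prime = ℕ.nonTrivial⇒n>1 p {{prime⇒nonTrivial p-prime}}

prime∤1 : Prime p → ¬ p ∣ℕ 1
prime∤1 p-prime p∣1 = ℕₚ.<⇒≢ (prime>1 p-prime) (sym (∣1⇒≡1 p∣1))

∃prime∣ : ∀ {n} → 1 < n → ∃[ p ] (Prime p × p ∣ℕ n)
∃prime∣ {n@(suc _)} 1<n with factorise n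
... | record { factors = [] ; isFactorisation = n≡1 } = contradiction n≡1 (ℕₚ.>⇒≢ 1<n)
... | record { factors = p ∷ ps ; isFactorisation = n≡p*∏ps ; factorsPrime = p-prime ∷ _ } =
  p , p-prime , subst (p ∣ℕ_) (sym n≡p*∏ps) (m∣m*n (product ps))

∣n! : ∀ {n} → 0 < p → p ≤ n → p ∣ℕ n !
∣n! {suc p} _ p≤n = ∣-trans (m∣m*n (p !)) (m≤n⇒m!∣n! p≤n)

prime∣*⇒∣⊎∣ : ∀ i j → Prime p → (+ p) ∣ℤ i * j → (+ p) ∣ℤ i ⊎ (+ p) ∣ℤ j
prime∣*⇒∣⊎∣ i j p-prime p∣ij = euclidsLemma ∣ i ∣ ∣ j ∣ p-prime (subst (_ ∣ℕ_) (ℤₚ.abs-* i j) p∣ij)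

prime∣^⇒∣ : ∀ i e → Prime p → (+ p) ∣ℤ i ^ e → (+ p) ∣ℤ i
prime∣^⇒∣ i zero    p-prime p∣1 = contradiction p∣1 (prime∤1 p-prime)
prime∣^⇒∣ i (suc e) p-prime p∣i^1+e with prime∣*⇒∣⊎∣ i (i ^ e) p-prime p∣i^1+e
... | inj₁ p∣i   = p∣i
... | inj₂ p∣i^e = prime∣^⇒∣ i e p-prime p∣i^e

∣⇒∣∣≤∣∣ : ∀ k → i ≢ 0ℤ → k ∣ℤ i → ∣ k ∣ ≤ ∣ i ∣
∣⇒∣∣≤∣∣ k i≢0 k∣i = ∣⇒≤ {{≢-nonZero i≢0}} k∣i

prime∣*^⇒≤ : ∀ i j e → Prime p → i ≢ 0ℤ → ¬ (+ p) ∣ℤ j → (+ p) ∣ℤ i * j ^ e → p ≤ ∣ i ∣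
prime∣*^⇒≤ {p} i j e p-prime i≢0 p∤j p∣ij^e with prime∣*⇒∣⊎∣ i (j ^ e) p-prime p∣ij^e
... | inj₁ p∣i   = ∣⇒∣∣≤∣∣ (+ p) i≢0 p∣i
... | inj₂ p∣j^e = contradiction (prime∣^⇒∣ j e p-prime p∣j^e) p∤j

∣i∣≤∣i*j∣ : ∀ {i j} → j ≢ 0ℤ → ∣ i ∣ ≤ ∣ i * j ∣
∣i∣≤∣i*j∣ {i} {j} j≢0 =
  subst (∣ i ∣ ≤_) (sym (ℤₚ.abs-* i j)) (ℕₚ.m≤m*n ∣ i ∣ ∣ j ∣ {{≢-nonZero j≢0}})

∣j∣≤∣i*j∣ : i ≢ 0ℤ → ∣ j ∣ ≤ ∣ i * j ∣
∣j∣≤∣i*j∣ {i} {j} i≢0 =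
  subst (∣ j ∣ ≤_) (sym (ℤₚ.abs-* i j)) (ℕₚ.m≤n*m ∣ j ∣ ∣ i ∣ {{≢-nonZero i≢0}})

1<∣1+i∣ : ∀ i → 2 < ∣ i ∣ → 1 < ∣ 1ℤ + i ∣
1<∣1+i∣ (+ n)                2<n = ℕₚ.<-trans (s≤s (s≤s z≤n)) (s≤s 2<n)
1<∣1+i∣ -[1+ suc (suc n) ]   _   = s≤s (s≤s z≤n)
1<∣1+i∣ -[1+ 0 ]             (s≤s ())
1<∣1+i∣ -[1+ 1 ]             (s≤s (s≤s ()))

-- Dense univariate polynomials

horner : List ℤ → ℤ → ℤ
horner []      w = 0ℤ
horner (a ∷ D) w = a + w * horner D w

NonZeroPoly : List ℤ → Set
NonZeroPoly = Any (_≢ 0ℤ)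

height : List ℤ → ℕ
height []      = 0
height (a ∷ D) = ∣ a ∣ ⊔ height D

∣∣≤height : ∀ D → All (λ a → ∣ a ∣ ≤ height D) D
∣∣≤height []      = []
∣∣≤height (a ∷ D) =
  ℕₚ.m≤m⊔n ∣ a ∣ (height D) ∷ All.map (ℕₚ.m≤n⇒m≤o⊔n ∣ a ∣) (∣∣≤height D)

-- A root w would divide a, forcing ∣w∣ ≤ ∣a∣ unless a = 0, in which case w divides out.
horner≢0 : ∀ {w D} → NonZeroPoly D → All (λ a → ∣ a ∣ < ∣ w ∣) D → horner D w ≢ 0ℤ
horner≢0 {w} {a ∷ D} D≢0 (∣a∣<∣w∣ ∷ D<∣w∣) Dw≡0 with a ≟ 0ℤ
... | no a≢0 = ℕₚ.<⇒≱ ∣a∣<∣w∣ (∣⇒∣∣≤∣∣ w a≢0 w∣a)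
  where
  w∣a : w ∣ℤ a
  w∣a = Signed.∣⇒∣ᵤ (Signed.∣m+n∣n⇒∣m {m = a}
          (subst (w Signed.∣_) (sym Dw≡0) (Signed.divides 0ℤ refl))
          (Signed.∣m⇒∣m*n (horner D w) Signed.∣-refl))
... | yes refl with D≢0
...   | here 0≢0     = 0≢0 refl
...   | there D'≢0 with ℤₚ.i*j≡0⇒i≡0∨j≡0 w (trans (sym (ℤₚ.+-identityˡ _)) Dw≡0)
...     | inj₁ w≡0 = ℕₚ.<⇒≢ ∣a∣<∣w∣ (sym (cong ∣_∣ w≡0))
...     | inj₂ H≡0 = horner≢0 D'≢0 D<∣w∣ H≡0

constantTerm : List ℤ → ℤ
constantTerm []      = 0ℤ
constantTerm (a ∷ _) = a

dropConstant : List ℤ → List ℤ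
dropConstant []      = []
dropConstant (_ ∷ D) = D

coeffAt : List ℤ → ℕ → ℤ
coeffAt D zero    = constantTerm D
coeffAt D (suc e) = coeffAt (dropConstant D) e

coeffAt-[] : ∀ e → coeffAt [] e ≡ 0ℤ
coeffAt-[] zero    = refl
coeffAt-[] (suc e) = coeffAt-[] e

coeffAt≢0⇒NonZeroPoly : ∀ D e → coeffAt D e ≢ 0ℤ → NonZeroPoly D
coeffAt≢0⇒NonZeroPoly []      e       0≢0 = contradiction (coeffAt-[] e) 0≢0
coeffAt≢0⇒NonZeroPoly (_ ∷ _) zero    a≢0 = here a≢0
coeffAt≢0⇒NonZeroPoly (_ ∷ D) (suc e) D≢0 = there (coeffAt≢0⇒NonZeroPoly D e D≢0)

data Shape (D : List ℤ) : Set where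
  vanishing   : (∀ w → horner D w ≡ 0ℤ) → Shape D
  monomial    : ∀ e → coeffAt D e ≢ 0ℤ → (∀ w → horner D w ≡ coeffAt D e * w ^ e) → Shape D
  nonMonomial : ∀ e R → coeffAt D e ≢ 0ℤ → NonZeroPoly R →
                (∀ w → horner D w ≡ w ^ e * (coeffAt D e + w * horner R w)) → Shape D

horner-0∷ : ∀ D w → horner (0ℤ ∷ D) w ≡ w * horner D w
horner-0∷ D w = ℤₚ.+-identityˡ (w * horner D w)

shape : ∀ D → Shape D
shape []      = vanishing (λ _ → refl)
shape (a ∷ D) with shape D | a ≟ 0ℤ
... | vanishing D≡0 | yes refl = vanishing λ w → begin
  horner (0ℤ ∷ D) w ≡⟨ horner-0∷ D w ⟩
  w * horner D w    ≡⟨ cong (w *_) (D≡0 w) ⟩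
  w * 0ℤ            ≡⟨ ℤₚ.*-zeroʳ w ⟩
  0ℤ                ∎
  where open ≡-Reasoning
... | vanishing D≡0 | no a≢0 = monomial 0 a≢0 λ w → begin
  a + w * horner D w ≡⟨ cong (λ h → a + w * h) (D≡0 w) ⟩
  a + w * 0ℤ         ≡⟨ cong (λ h → a + h) (ℤₚ.*-zeroʳ w) ⟩
  a + 0ℤ             ≡⟨ ℤₚ.+-identityʳ a ⟩
  a                  ≡⟨ ℤₚ.*-identityʳ a ⟨
  a * 1ℤ             ∎
  where open ≡-Reasoning
... | monomial e c≢0 D≡cwᵉ | yes refl = monomial (suc e) c≢0 λ w → begin
  horner (0ℤ ∷ D) w ≡⟨ horner-0∷ D w ⟩
  w * horner D w    ≡⟨ cong (w *_) (D≡cwᵉ w) ⟩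
  w * (c * w ^ e)   ≡⟨ i*[j*k]≡j*[i*k] w c (w ^ e) ⟩
  c * (w * w ^ e)   ∎
  where
  open ≡-Reasoning
  c : ℤ
  c = coeffAt D e
... | monomial e D≢0 _ | no a≢0 =
  nonMonomial 0 D a≢0 (coeffAt≢0⇒NonZeroPoly D e D≢0) (λ w → sym (ℤₚ.*-identityˡ _))
... | nonMonomial e R c≢0 R≢0 D≡wᵉ[c+wR] | yes refl =
  nonMonomial (suc e) R c≢0 R≢0 λ w → begin
  horner (0ℤ ∷ D) w                         ≡⟨ horner-0∷ D w ⟩
  w * horner D w                            ≡⟨ cong (w *_) (D≡wᵉ[c+wR] w) ⟩
  w * (w ^ e * (c + w * horner R w))        ≡⟨ ℤₚ.*-assoc w (w ^ e) _ ⟨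
  w * w ^ e * (c + w * horner R w)          ∎
  where
  open ≡-Reasoning
  c : ℤ
  c = coeffAt D e
... | nonMonomial e _ D≢0 _ _ | no a≢0 =
  nonMonomial 0 D a≢0 (coeffAt≢0⇒NonZeroPoly D e D≢0) (λ w → sym (ℤₚ.*-identityˡ _))

-- Schur's theorem

-- With w = c·u we have F(w) = wᵉ·c·(1 + u·R(w)); a prime factor q of 1 + u·R(w) does not
-- divide u, hence divides neither c nor w.
schurPrime : ∀ e {c} R u → c ≢ 0ℤ → NonZeroPoly R → c Signed.∣ u → height R < ∣ u ∣ → 2 < ∣ u ∣ →
             ∃[ q ] (Prime q × ¬ (+ q) Signed.∣ u × ¬ (+ q) ∣ℤ c * u ×
                     (+ q) ∣ℤ (c * u) ^ e * (c + c * u * horner R (c * u)))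
schurPrime e {c} R u c≢0 R≢0 c∣u height<∣u∣ 2<∣u∣ = q , q-prime , q∤u , q∤w , q∣Fw
  where
  w : ℤ
  w = c * u
  H : ℤ
  H = horner R w

  H≢0 : H ≢ 0ℤ
  H≢0 = horner≢0 R≢0 (All.map (λ ∣a∣≤h → ℕₚ.≤-<-trans ∣a∣≤h height<∣w∣) (∣∣≤height R))
    where
    height<∣w∣ : height R < ∣ w ∣
    height<∣w∣ = ℕₚ.<-≤-trans height<∣u∣ (∣j∣≤∣i*j∣ {c} {u} c≢0)

  prime-factor : ∃[ q ] (Prime q × q ∣ℕ ∣ 1ℤ + u * H ∣)
  prime-factor = ∃prime∣ (1<∣1+i∣ (u * H) (ℕₚ.<-≤-trans 2<∣u∣ (∣i∣≤∣i*j∣ {u} {H} H≢0)))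
  q : ℕ
  q = proj₁ prime-factor
  q-prime : Prime q
  q-prime = proj₁ (proj₂ prime-factor)
  q∣1+uH : (+ q) Signed.∣ 1ℤ + u * H
  q∣1+uH = Signed.∣ᵤ⇒∣ {+ q} {1ℤ + u * H} (proj₂ (proj₂ prime-factor))

  q∤u : ¬ (+ q) Signed.∣ u
  q∤u q∣u = prime∤1 q-prime
    (Signed.∣⇒∣ᵤ (Signed.∣m+n∣n⇒∣m {+ q} {1ℤ} {u * H} q∣1+uH (Signed.∣m⇒∣m*n H q∣u)))

  q∤w : ¬ (+ q) ∣ℤ w
  q∤w q∣cu with prime∣*⇒∣⊎∣ c u q-prime q∣cu
  ... | inj₁ q∣c = q∤u (Signed.∣-trans (Signed.∣ᵤ⇒∣ {+ q} {c} q∣c) c∣u)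
  ... | inj₂ q∣u = q∤u (Signed.∣ᵤ⇒∣ {+ q} {u} q∣u)

  q∣Fw : (+ q) ∣ℤ w ^ e * (c + w * H)
  q∣Fw = Signed.∣⇒∣ᵤ (Signed.∣n⇒∣m*n (w ^ e)
           (subst ((+ q) Signed.∣_) c[1+uH]≡c+wH (Signed.∣n⇒∣m*n c q∣1+uH)))
    where
    c[1+uH]≡c+wH : c * (1ℤ + u * H) ≡ c + w * H
    c[1+uH]≡c+wH = begin
      c * (1ℤ + u * H)      ≡⟨ ℤₚ.*-distribˡ-+ c 1ℤ (u * H) ⟩
      c * 1ℤ + c * (u * H)  ≡⟨ cong₂ _+_ (ℤₚ.*-identityʳ c) (sym (ℤₚ.*-assoc c u H)) ⟩
      c + w * H             ∎
      where open ≡-Reasoning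

schur : ∀ e {c} R → c ≢ 0ℤ → NonZeroPoly R →
        InfinitelyManyPrimesWithNonzeroRoot (λ w → w ^ e * (c + w * horner R w))
schur e {c} R c≢0 R≢0 N =
  let q , q-prime , q∤u , q∤cu , q∣Fcu = schurPrime e R u c≢0 R≢0 c∣u height<∣u∣ 2<∣u∣
  in  q , N<q q-prime q∤u , q-prime , c * u , q∤cu , q∣Fcu
  where
  -- N! ∣ u forces q > N; x = 3 + height R makes R(c·u) ≠ 0 and ∣u·R(c·u)∣ > 2.
  x : ℕ
  x = 3 ℕ.+ height R
  u : ℤ
  u = c * + (N ! ℕ.* x)

  c∣u : c Signed.∣ u
  c∣u = Signed.∣m⇒∣m*n (+ (N ! ℕ.* x)) Signed.∣-refl

  x≤∣u∣ : x ≤ ∣ u ∣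
  x≤∣u∣ = ℕₚ.≤-trans (ℕₚ.m≤n*m x (N !) {{N ℕₚ.!≢0}}) (∣j∣≤∣i*j∣ {c} {+ (N ! ℕ.* x)} c≢0)

  height<∣u∣ : height R < ∣ u ∣
  height<∣u∣ = ℕₚ.<-≤-trans (ℕₚ.m<n+m (height R) {3} (s≤s z≤n)) x≤∣u∣

  2<∣u∣ : 2 < ∣ u ∣
  2<∣u∣ = ℕₚ.≤-trans (ℕₚ.m≤m+n 3 (height R)) x≤∣u∣

  N<q : ∀ {q} → Prime q → ¬ (+ q) Signed.∣ u → N < q
  N<q {q} q-prime q∤u = ℕₚ.≰⇒> λ q≤N → q∤u (Signed.∣n⇒∣m*n c {+ (N ! ℕ.* x)}
    (Signed.∣ᵤ⇒∣ {+ q} {+ (N ! ℕ.* x)} (∣-trans (∣n! (ℕₚ.<⇒≤ (prime>1 q-prime)) q≤N) (m∣m*n x))))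

-- Euclid's theorem is the case 1 + w of Schur's.
∃prime> : ∀ N → ∃[ p ] (N < p × Prime p)
∃prime> N = map₂ (map₂ proj₁) (primes N)
  where
  primes : InfinitelyManyPrimesWithNonzeroRoot (λ w → w ^ 0 * (1ℤ + w * horner (1ℤ ∷ []) w))
  primes = schur 0 {1ℤ} (1ℤ ∷ []) (λ ()) (here (λ ()))

Terms : Set
Terms = List (ℤ × ℕ)

evalTerms : Terms → ℤ → ℤ
evalTerms S w = sum (map (λ { (c , d) → c * w ^ d }) S)

‖_‖ : ∀ {A : Set} → List (ℤ × A) → ℕ
‖ [] ‖          = 0
‖ (c , _) ∷ S ‖ = ∣ c ∣ ℕ.+ ‖ S ‖

addAt : ℕ → ℤ → List ℤ → List ℤ
addAt zero    c D = c + constantTerm D ∷ dropConstant D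
addAt (suc d) c D = constantTerm D ∷ addAt d c (dropConstant D)

toDense : Terms → List ℤ
toDense []            = []
toDense ((c , d) ∷ S) = addAt d c (toDense S)

horner-constantTerm : ∀ D w → horner D w ≡ constantTerm D + w * horner (dropConstant D) w
horner-constantTerm []      w = sym (trans (ℤₚ.+-identityˡ (w * 0ℤ)) (ℤₚ.*-zeroʳ w))
horner-constantTerm (_ ∷ _) w = refl

horner-addAt : ∀ d c D w → horner (addAt d c D) w ≡ c * w ^ d + horner D w
horner-addAt zero c D w = begin
  c + constantTerm D + w * horner (dropConstant D) w
    ≡⟨ reassoc c _ _ ⟩
  c * 1ℤ + (constantTerm D + w * horner (dropConstant D) w)
    ≡⟨ cong (λ h → c * 1ℤ + h) (horner-constantTerm D w) ⟨
  c * 1ℤ + horner D w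
    ∎
  where
  open ≡-Reasoning
  reassoc : ∀ c a h → c + a + h ≡ c * 1ℤ + (a + h)
  reassoc = solve-∀
horner-addAt (suc d) c D w = begin
  constantTerm D + w * horner (addAt d c (dropConstant D)) w
    ≡⟨ cong (λ h → constantTerm D + w * h) (horner-addAt d c (dropConstant D) w) ⟩
  constantTerm D + w * (c * w ^ d + horner (dropConstant D) w)
    ≡⟨ distrib c (constantTerm D) w (w ^ d) _ ⟩
  c * (w * w ^ d) + (constantTerm D + w * horner (dropConstant D) w)
    ≡⟨ cong (λ h → c * (w * w ^ d) + h) (horner-constantTerm D w) ⟨
  c * (w * w ^ d) + horner D w
    ∎
  where
  open ≡-Reasoning
  distrib : ∀ c a w x h → a + w * (c * x + h) ≡ c * (w * x) + (a + w * h)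
  distrib = solve-∀

horner-toDense : ∀ S w → horner (toDense S) w ≡ evalTerms S w
horner-toDense []            w = refl
horner-toDense ((c , d) ∷ S) w =
  trans (horner-addAt d c (toDense S) w) (cong (λ h → c * w ^ d + h) (horner-toDense S w))

coeffAt-addAt-≡ : ∀ d c D → coeffAt (addAt d c D) d ≡ c + coeffAt D d
coeffAt-addAt-≡ zero    c D = refl
coeffAt-addAt-≡ (suc d) c D = coeffAt-addAt-≡ d c (dropConstant D)

coeffAt-addAt-≢ : ∀ d c D e → d ≢ e → coeffAt (addAt d c D) e ≡ coeffAt D e
coeffAt-addAt-≢ zero    c D zero    0≢0 = contradiction refl 0≢0
coeffAt-addAt-≢ zero    c D (suc e) _   = refl
coeffAt-addAt-≢ (suc d) c D zero    _   = refl
coeffAt-addAt-≢ (suc d) c D (suc e) d≢e = coeffAt-addAt-≢ d c (dropConstant D) e (d≢e ∘ cong suc)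

∣coeffAt-toDense∣≤‖‖ : ∀ S e → ∣ coeffAt (toDense S) e ∣ ≤ ‖ S ‖
∣coeffAt-toDense∣≤‖‖ []            e = ℕₚ.≤-reflexive (cong ∣_∣ (coeffAt-[] e))
∣coeffAt-toDense∣≤‖‖ ((c , d) ∷ S) e with d ℕ.≟ e
... | yes refl = begin
  ∣ coeffAt (addAt d c (toDense S)) d ∣ ≡⟨ cong ∣_∣ (coeffAt-addAt-≡ d c (toDense S)) ⟩
  ∣ c + coeffAt (toDense S) d ∣         ≤⟨ ℤₚ.∣i+j∣≤∣i∣+∣j∣ c _ ⟩
  ∣ c ∣ ℕ.+ ∣ coeffAt (toDense S) d ∣   ≤⟨ ℕₚ.+-monoʳ-≤ ∣ c ∣ (∣coeffAt-toDense∣≤‖‖ S d) ⟩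
  ∣ c ∣ ℕ.+ ‖ S ‖                       ∎
  where open ℕₚ.≤-Reasoning
... | no d≢e = begin
  ∣ coeffAt (addAt d c (toDense S)) e ∣ ≡⟨ cong ∣_∣ (coeffAt-addAt-≢ d c (toDense S) e d≢e) ⟩
  ∣ coeffAt (toDense S) e ∣             ≤⟨ ∣coeffAt-toDense∣≤‖‖ S e ⟩
  ‖ S ‖                                 ≤⟨ ℕₚ.m≤n+m ‖ S ‖ ∣ c ∣ ⟩
  ∣ c ∣ ℕ.+ ‖ S ‖                       ∎
  where open ℕₚ.≤-Reasoning

-- Roots of P̃ and the size of its shifts

tildeTerms : ∀ {n} → Poly n → Terms
tildeTerms = map (λ { (c , β) → c , deg β })

evalMono-replicate : ∀ {n} (β : Mono n) w → evalMono β (replicate n w) ≡ w ^ deg β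
evalMono-replicate []      w = refl
evalMono-replicate (k ∷ β) w =
  trans (cong (w ^ k *_) (evalMono-replicate β w)) (sym (ℤₚ.^-distribˡ-+-* w k (deg β)))

tilde≡evalTerms : ∀ {n} (P : Poly n) w → tilde P w ≡ evalTerms (tildeTerms P) w
tilde≡evalTerms P w = cong sum (trans
  (List.map-cong (λ { (c , β) → cong (c *_) (evalMono-replicate β w) }) P)
  (List.map-∘ P))

tildeCoeff≡coeffAt : ∀ {n} (P : Poly n) d → tildeCoeff P d ≡ coeffAt (toDense (tildeTerms P)) d
tildeCoeff≡coeffAt []            d = sym (coeffAt-[] d)
tildeCoeff≡coeffAt ((c , β) ∷ P) d with deg β ℕ.≡ᵇ d in deg≡ᵇd
... | true with refl ← ℕₚ.≡ᵇ⇒≡ (deg β) d (subst T (sym deg≡ᵇd) tt) =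
  trans (cong (λ s → c + s) (tildeCoeff≡coeffAt P d)) (sym (coeffAt-addAt-≡ d c _))
... | false = trans (tildeCoeff≡coeffAt P d) (sym (coeffAt-addAt-≢ (deg β) c _ d deg≢d))
  where
  deg≢d : deg β ≢ d
  deg≢d deg≡d = subst T deg≡ᵇd (ℕₚ.≡⇒≡ᵇ (deg β) d deg≡d)

TildeNonzero⇒∃≢0 : ∀ {n} (P : Poly n) → TildeNonzero P → ∃[ w ] tilde P w ≢ 0ℤ
TildeNonzero⇒∃≢0 P (d , tildeCoeff≢0) = w , λ tildePw≡0 →
  horner≢0 D≢0 (All.map s≤s (∣∣≤height D))
    (trans (horner-toDense (tildeTerms P) w) (trans (sym (tilde≡evalTerms P w)) tildePw≡0))
  where
  D : List ℤ
  D = toDense (tildeTerms P)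
  w : ℤ
  w = + suc (height D)
  D≢0 : NonZeroPoly D
  D≢0 = coeffAt≢0⇒NonZeroPoly D d (tildeCoeff≢0 ∘ trans (tildeCoeff≡coeffAt P d))

∣root∣≤∣constant∣ : ∀ {b e w} → b ≢ 0ℤ → b * w + e ≡ 0ℤ → ∣ w ∣ ≤ ∣ e ∣
∣root∣≤∣constant∣ {b} {e} {w} b≢0 bw+e≡0 = begin
  ∣ w ∣     ≤⟨ ∣j∣≤∣i*j∣ {b} {w} b≢0 ⟩
  ∣ b * w ∣ ≡⟨ cong ∣_∣ bw≡-e ⟩
  ∣ - e ∣   ≡⟨ ℤₚ.∣-i∣≡∣i∣ e ⟩
  ∣ e ∣     ∎
  where
  open ℕₚ.≤-Reasoning
  x≡x+e-e : ∀ x e → x ≡ x + e + - e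
  x≡x+e-e = solve-∀
  bw≡-e : b * w ≡ - e
  bw≡-e = trans (x≡x+e-e (b * w) e) (trans (cong (_+ - e) bw+e≡0) (ℤₚ.+-identityˡ (- e)))

rootBound : ∀ {n} (P : Poly n) → SplitsOverℤ P → ℕ
rootBound _ (_ , factors , _) = ‖ map swap factors ‖

-- F is abstracted because the linear factors in SplitsOverℤ are built by an anonymous
-- pattern-matching function, which is only known to compute on pairs.
∣root∣≤‖‖ : ∀ {w} (F : ℤ × ℤ → ℤ) → (∀ b e → F (b , e) ≡ b * w + e) →
            ∀ factors → (∀ {b e} → (b , e) ∈ factors → b ≢ 0ℤ) →
            prodℤ (map F factors) ≡ 0ℤ → ∣ w ∣ ≤ ‖ map swap factors ‖
∣root∣≤‖‖ F F≡ ((b , e) ∷ factors) b≢0 ∏≡0 with ℤₚ.i*j≡0⇒i≡0∨j≡0 (F (b , e)) ∏≡0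
... | inj₁ root = ℕₚ.≤-trans (∣root∣≤∣constant∣ (b≢0 (here refl)) (trans (sym (F≡ b e)) root))
                             (ℕₚ.m≤m+n ∣ e ∣ _)
... | inj₂ ∏′≡0 = ℕₚ.m≤n⇒m≤o+n ∣ e ∣ (∣root∣≤‖‖ F F≡ factors (b≢0 ∘ there) ∏′≡0)

∣root∣≤rootBound : ∀ {n} (P : Poly n) → TildeNonzero P → (split : SplitsOverℤ P) →
                   ∀ {a} → tilde P a ≡ 0ℤ → ∣ a ∣ ≤ rootBound P split
∣root∣≤rootBound P nonzero (c , factors , b≢0 , tilde≡c∏) {a} root
  with ℤₚ.i*j≡0⇒i≡0∨j≡0 c (trans (sym (tilde≡c∏ a)) root)
... | inj₂ ∏≡0 = ∣root∣≤‖‖ _ (λ _ _ → refl) factors b≢0 ∏≡0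
... | inj₁ refl =
  let w , tildePw≢0 = TildeNonzero⇒∃≢0 P nonzero
  in  contradiction (tilde≡c∏ w) tildePw≢0

∣i^n∣≡∣i∣^n : ∀ i n → ∣ i ^ n ∣ ≡ ∣ i ∣ ℕ.^ n
∣i^n∣≡∣i∣^n i zero    = refl
∣i^n∣≡∣i∣^n i (suc n) = trans (ℤₚ.abs-* i (i ^ n)) (cong (∣ i ∣ ℕ.*_) (∣i^n∣≡∣i∣^n i n))

∣binomFactor∣-mono : ∀ {n} (β γ : Mono n) {r s} → ∣ r ∣ ≤ ∣ s ∣ →
                     ∣ binomFactor β γ r ∣ ≤ ∣ binomFactor β γ s ∣
∣binomFactor∣-mono []      []      r≤s = ℕₚ.≤-refl
∣binomFactor∣-mono (b ∷ β) (g ∷ γ) {r} {s} r≤s = begin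
  ∣ + (b C g) * r ^ (b ∸ g) * binomFactor β γ r ∣  ≡⟨ ∣k*iᵐ*j∣ r (binomFactor β γ r) ⟩
  (b C g) ℕ.* ∣ r ∣ ℕ.^ (b ∸ g) ℕ.* ∣ binomFactor β γ r ∣
    ≤⟨ ℕₚ.*-mono-≤ (ℕₚ.*-monoʳ-≤ (b C g) (ℕₚ.^-monoˡ-≤ (b ∸ g) r≤s)) (∣binomFactor∣-mono β γ r≤s) ⟩
  (b C g) ℕ.* ∣ s ∣ ℕ.^ (b ∸ g) ℕ.* ∣ binomFactor β γ s ∣
                                                   ≡⟨ ∣k*iᵐ*j∣ s (binomFactor β γ s) ⟨
  ∣ + (b C g) * s ^ (b ∸ g) * binomFactor β γ s ∣  ∎
  where
  open ℕₚ.≤-Reasoning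
  ∣k*iᵐ*j∣ : ∀ i j → ∣ + (b C g) * i ^ (b ∸ g) * j ∣ ≡ (b C g) ℕ.* ∣ i ∣ ℕ.^ (b ∸ g) ℕ.* ∣ j ∣
  ∣k*iᵐ*j∣ i j = trans (ℤₚ.abs-* (+ (b C g) * i ^ (b ∸ g)) j) (cong (ℕ._* ∣ j ∣)
    (trans (ℤₚ.abs-* (+ (b C g)) (i ^ (b ∸ g))) (cong ((b C g) ℕ.*_) (∣i^n∣≡∣i∣^n i (b ∸ g)))))

‖‖-++ : ∀ {A : Set} (S T : List (ℤ × A)) → ‖ S ++ T ‖ ≡ ‖ S ‖ ℕ.+ ‖ T ‖
‖‖-++ []            T = refl
‖‖-++ ((c , _) ∷ S) T = trans (cong (∣ c ∣ ℕ.+_) (‖‖-++ S T)) (sym (ℕₚ.+-assoc ∣ c ∣ ‖ S ‖ ‖ T ‖))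

‖shift‖-mono : ∀ {n} (P : Poly n) {r s} → ∣ r ∣ ≤ ∣ s ∣ → ‖ shift P r ‖ ≤ ‖ shift P s ‖
‖shift‖-mono []            r≤s = z≤n
‖shift‖-mono {n} ((c , β) ∷ P) {r} {s} r≤s = begin
  ‖ expand r ++ shift P r ‖          ≡⟨ ‖‖-++ (expand r) (shift P r) ⟩
  ‖ expand r ‖ ℕ.+ ‖ shift P r ‖     ≤⟨ ℕₚ.+-mono-≤ (expand-mono (box β)) (‖shift‖-mono P r≤s) ⟩
  ‖ expand s ‖ ℕ.+ ‖ shift P s ‖     ≡⟨ ‖‖-++ (expand s) (shift P s) ⟨
  ‖ expand s ++ shift P s ‖          ∎
  where
  open ℕₚ.≤-Reasoning
  expandOver : List (Mono n) → ℤ → Poly n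
  expandOver G t = map (λ γ → (c * binomFactor β γ t , γ)) G
  expand : ℤ → Poly n
  expand = expandOver (box β)
  expand-mono : ∀ G → ‖ expandOver G r ‖ ≤ ‖ expandOver G s ‖
  expand-mono []      = z≤n
  expand-mono (γ ∷ G) = ℕₚ.+-mono-≤
    (subst₂ _≤_ (sym (ℤₚ.abs-* c _)) (sym (ℤₚ.abs-* c _))
      (ℕₚ.*-monoʳ-≤ ∣ c ∣ (∣binomFactor∣-mono β γ r≤s)))
    (expand-mono G)

partTerms : ∀ {n} → Poly n → List (Mono n) → Terms
partTerms Q = map (λ α → coeff Q α , deg α)

partPoly≡evalTerms : ∀ {n} (Q : Poly n) J w → partPoly Q J w ≡ evalTerms (partTerms Q J) w
partPoly≡evalTerms Q J w = cong sum (List.map-∘ J)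

‖partTerms[]‖≡0 : ∀ {n} (J : List (Mono n)) → ‖ partTerms [] J ‖ ≡ 0
‖partTerms[]‖≡0 []      = refl
‖partTerms[]‖≡0 (_ ∷ J) = ‖partTerms[]‖≡0 J

‖partTerms‖-fresh : ∀ {n} c {β} (Q : Poly n) {J} → All (β ≢_) J →
                    ‖ partTerms ((c , β) ∷ Q) J ‖ ≡ ‖ partTerms Q J ‖
‖partTerms‖-fresh c Q []                        = refl
‖partTerms‖-fresh c {β} Q {α ∷ J} (β≢α ∷ β∉J) with ≡-dec ℕ._≟_ β α
... | yes β≡α = contradiction β≡α β≢α
... | no  _   = cong (∣ coeff Q α ∣ ℕ.+_) (‖partTerms‖-fresh c Q β∉J)

-- Since J has no repeated exponent, the new term (c , β) contributes to at most one α ∈ J.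
‖partTerms‖-∷ : ∀ {n} c β (Q : Poly n) {J} → Unique J →
                ‖ partTerms ((c , β) ∷ Q) J ‖ ≤ ∣ c ∣ ℕ.+ ‖ partTerms Q J ‖
‖partTerms‖-∷ c β Q []                       = z≤n
‖partTerms‖-∷ c β Q {α ∷ J} (α∉J ∷ J-unique) with ≡-dec ℕ._≟_ β α
... | yes refl = begin
  ∣ c + coeff Q β ∣ ℕ.+ ‖ partTerms ((c , β) ∷ Q) J ‖
    ≡⟨ cong (∣ c + coeff Q β ∣ ℕ.+_) (‖partTerms‖-fresh c Q α∉J) ⟩
  ∣ c + coeff Q β ∣ ℕ.+ ‖ partTerms Q J ‖
    ≤⟨ ℕₚ.+-monoˡ-≤ _ (ℤₚ.∣i+j∣≤∣i∣+∣j∣ c (coeff Q β)) ⟩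
  ∣ c ∣ ℕ.+ ∣ coeff Q β ∣ ℕ.+ ‖ partTerms Q J ‖
    ≡⟨ ℕₚ.+-assoc ∣ c ∣ _ _ ⟩
  ∣ c ∣ ℕ.+ (∣ coeff Q β ∣ ℕ.+ ‖ partTerms Q J ‖) ∎
  where open ℕₚ.≤-Reasoning
... | no _ = begin
  ∣ coeff Q α ∣ ℕ.+ ‖ partTerms ((c , β) ∷ Q) J ‖
    ≤⟨ ℕₚ.+-monoʳ-≤ ∣ coeff Q α ∣ (‖partTerms‖-∷ c β Q J-unique) ⟩
  ∣ coeff Q α ∣ ℕ.+ (∣ c ∣ ℕ.+ ‖ partTerms Q J ‖)
    ≡⟨ m+[n+o]≡n+[m+o] ∣ coeff Q α ∣ ∣ c ∣ _ ⟩
  ∣ c ∣ ℕ.+ (∣ coeff Q α ∣ ℕ.+ ‖ partTerms Q J ‖) ∎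
  where open ℕₚ.≤-Reasoning

‖partTerms‖≤‖‖ : ∀ {n} (Q : Poly n) {J} → Unique J → ‖ partTerms Q J ‖ ≤ ‖ Q ‖
‖partTerms‖≤‖‖ []            {J} _        = ℕₚ.≤-reflexive (‖partTerms[]‖≡0 J)
‖partTerms‖≤‖‖ ((c , β) ∷ Q) J-unique =
  ℕₚ.≤-trans (‖partTerms‖-∷ c β Q J-unique) (ℕₚ.+-monoʳ-≤ ∣ c ∣ (‖partTerms‖≤‖‖ Q J-unique))

infinitelyManyPrimes-cong : ∀ {F G : ℤ → ℤ} → F ≗ G →
  InfinitelyManyPrimesWithNonzeroRoot F → InfinitelyManyPrimesWithNonzeroRoot G
infinitelyManyPrimes-cong F≗G primes N =
  let p , N<p , p-prime , w , p∤w , p∣Fw = primes N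
  in  p , N<p , p-prime , w , p∤w , subst ((+ p) ∣ℤ_) (F≗G w) p∣Fw

-- A monomial c·wᵉ has no root that is a unit mod p once p > ∣c∣; the other shapes are
-- Schur's case or vanish identically.
unitRoot⇒infinitelyManyPrimes : ∀ D {p x} → Prime p → (∀ e → ∣ coeffAt D e ∣ < p) →
  ¬ (+ p) ∣ℤ x → (+ p) ∣ℤ horner D x → InfinitelyManyPrimesWithNonzeroRoot (horner D)
unitRoot⇒infinitelyManyPrimes D {p} {x} p-prime D<p p∤x p∣Dx with shape D
... | vanishing D≡0 = λ N →
  let q , N<q , q-prime = ∃prime> N
  in  q , N<q , q-prime , 1ℤ , prime∤1 q-prime , subst ((+ q) ∣ℤ_) (sym (D≡0 1ℤ)) (q ∣0)
... | monomial e c≢0 D≡cwᵉ = contradiction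
  (prime∣*^⇒≤ (coeffAt D e) x e p-prime c≢0 p∤x (subst ((+ p) ∣ℤ_) (D≡cwᵉ x) p∣Dx))
  (ℕₚ.<⇒≱ (D<p e))
... | nonMonomial e R c≢0 R≢0 D≡wᵉ[c+wR] =
  infinitelyManyPrimes-cong (sym ∘ D≡wᵉ[c+wR]) (schur e R c≢0 R≢0)

partPoly-unitRoot⇒infinitelyManyPrimes : ∀ {n} (Q : Poly n) {J p x} → Prime p → Unique J →
  ‖ Q ‖ < p → ¬ (+ p) ∣ℤ x → (+ p) ∣ℤ partPoly Q J x →
  InfinitelyManyPrimesWithNonzeroRoot (partPoly Q J)
partPoly-unitRoot⇒infinitelyManyPrimes Q {J} {p} {x} p-prime J-unique ‖Q‖<p p∤x p∣Qx =
  infinitelyManyPrimes-cong (sym ∘ partPoly≗horner)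
    (unitRoot⇒infinitelyManyPrimes D p-prime D<p p∤x (subst ((+ p) ∣ℤ_) (partPoly≗horner x) p∣Qx))
  where
  D : List ℤ
  D = toDense (partTerms Q J)
  partPoly≗horner : partPoly Q J ≗ horner D
  partPoly≗horner w = trans (partPoly≡evalTerms Q J w) (sym (horner-toDense (partTerms Q J) w))
  D<p : ∀ e → ∣ coeffAt D e ∣ < p
  D<p e = ℕₚ.≤-<-trans (∣coeffAt-toDense∣≤‖‖ (partTerms Q J) e)
            (ℕₚ.≤-<-trans (‖partTerms‖≤‖‖ Q J-unique) ‖Q‖<p)

module _ {n ℓ m} (Q : Poly n) (J : Fin (suc ℓ) → List (Mono n)) (d : Fin m → ℕ) (m≤ℓ : m ≤ ℓ)
         (functional : MinimalRadoFunctional Q J d m≤ℓ) where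

  functional⇒unique : Unique (J fzero)
  functional⇒unique =
    let _ , _ , _ , _ , determines , _ = proj₂ functional 1 (λ _ → fzero) 0 []
    in  proj₁ (proj₂ (proj₂ (proj₂ determines))) fzero

  functional⇒minimalRadoSet : MinimalRadoSet Q (J fzero)
  functional⇒minimalRadoSet = ℓ , J , partition , refl
    where
    partition : RadoPartition Q J
    partition k c L =
      let t , t∉L , (_ , monochromatic) , M , determines , _ = proj₂ functional k c 0 L
      in  t , t∉L , monochromatic , M , determines

∣sum : ∀ {k} xs → All (k Signed.∣_) xs → k Signed.∣ sum xs
∣sum []       []          = Signed.divides 0ℤ refl
∣sum (_ ∷ xs) (k∣x ∷ k∣xs) = Signed.∣m∣n⇒∣m+n k∣x (∣sum xs k∣xs)

-- radoEq unfolds to p⁰·X + Σ_{j ≥ 1} p^dⱼ·(…), where X is the J₀ part and every dⱼ ≥ 1.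
p∣radoEq⇒p∣partPoly : ∀ {n ℓ m} p (Q : Poly n) J (d : Fin m → ℕ) (m≤ℓ : m ≤ ℓ) →
  (∀ j → 1 ≤ d j) → ∀ w → (+ p) ^ 1 ∣ℤ radoEq p Q J d m≤ℓ w → (+ p) ∣ℤ partPoly Q (J fzero) w
p∣radoEq⇒p∣partPoly {m = m} p Q J d m≤ℓ d≥1 w p∣radoEq =
  Signed.∣⇒∣ᵤ (subst ((+ p) Signed.∣_) (ℤₚ.*-identityˡ X) (Signed.∣m+n∣n⇒∣m p∣X+higher p∣higher))
  where
  X : ℤ
  X = partPoly Q (J fzero) w
  summand : Fin (suc m) → ℤ
  summand j = (+ p) ^ dExt d j * partPoly Q (J (inject≤ j (s≤s m≤ℓ))) w
  higher : List ℤ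
  higher = map summand (tabulate fsuc)
  p∣X+higher : (+ p) Signed.∣ 1ℤ * X + sum higher
  p∣X+higher = Signed.∣ᵤ⇒∣ {+ p} {radoEq p Q J d m≤ℓ w}
    (subst (_∣ℤ radoEq p Q J d m≤ℓ w) (ℤₚ.*-identityʳ (+ p)) p∣radoEq)
  p∣p^ : ∀ k → 1 ≤ k → (+ p) Signed.∣ (+ p) ^ k
  p∣p^ (suc k) _ = Signed.∣m⇒∣m*n ((+ p) ^ k) Signed.∣-refl
  p∣higher : (+ p) Signed.∣ sum higher
  p∣higher = ∣sum higher (All.map⁺ (All.tabulate⁺ λ j → Signed.∣m⇒∣m*n _ (p∣p^ (d j) (d≥1 j))))

partPoly-homogeneous : ∀ {n} (Q : Poly n) J k w → All (λ α → deg α ≡ k) J →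
  partPoly Q J w ≡ sum (map (coeff Q) J) * w ^ k
partPoly-homogeneous Q []      k w []              = refl
partPoly-homogeneous Q (α ∷ J) k w (refl ∷ degJ≡k) = begin
  coeff Q α * w ^ k + partPoly Q J w
    ≡⟨ cong (λ s → coeff Q α * w ^ k + s) (partPoly-homogeneous Q J k w degJ≡k) ⟩
  coeff Q α * w ^ k + sum (map (coeff Q) J) * w ^ k
    ≡⟨ ℤₚ.*-distribʳ-+ (w ^ k) (coeff Q α) _ ⟨
  (coeff Q α + sum (map (coeff Q) J)) * w ^ k
    ∎
  where open ≡-Reasoning

-- A nonzero S·wᵏ has a root that is a unit mod q only for the primes q ≤ ∣S∣.
homogeneous⇒coeffSum≡0 : ∀ {n} (Q : Poly n) J →
  InfinitelyManyPrimesWithNonzeroRoot (partPoly Q J) → Homogeneous J → sum (map (coeff Q) J) ≡ 0ℤ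
homogeneous⇒coeffSum≡0 Q []      _      _           = refl
homogeneous⇒coeffSum≡0 Q (α ∷ J) primes homogeneous with sum (map (coeff Q) (α ∷ J)) ≟ 0ℤ
... | yes S≡0 = S≡0
... | no  S≢0 =
  let q , ∣S∣<q , q-prime , w , q∤w , q∣Qw = primes ∣ S ∣
      q∣Swᵏ = subst ((+ q) ∣ℤ_) (partPoly-homogeneous Q (α ∷ J) (deg α) w degJ≡degα) q∣Qw
  in  contradiction (prime∣*^⇒≤ S w (deg α) q-prime S≢0 q∤w q∣Swᵏ) (ℕₚ.<⇒≱ ∣S∣<q)
  where
  S : ℤ
  S = sum (map (coeff Q) (α ∷ J))
  degJ≡degα : All (λ β → deg β ≡ deg α) (α ∷ J)
  degJ≡degα = All.tabulate (λ β∈J → homogeneous β∈J (here refl))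

lemma2p18 : ∀ {n : ℕ} (P : Poly n) →
    TildeNonzero P → SplitsOverℤ P → MinimalRadoCondition P →
    ∃[ a ] (tilde P a ≡ + 0 ×
      Σ (List (Mono n)) λ J →
        MinimalRadoSet (shift P a) J ×
        InfinitelyManyPrimesWithNonzeroRoot (partPoly (shift P a) J) ×
        (Homogeneous J → sum (map (coeff (shift P a)) J) ≡ + 0))
lemma2p18 P nonzero split rado =
  let p , bound<p , p-prime = ∃prime> ‖ shift P (+ rootBound P split) ‖
      a , a-root , _ , _ , J , d , m≤ℓ , functional , x , _ , x-root , x-unit = rado p p-prime
      ‖shiftPa‖<p = ℕₚ.≤-<-trans (‖shift‖-mono P (∣root∣≤rootBound P nonzero split a-root)) bound<p
      primes = partPoly-unitRoot⇒infinitelyManyPrimes (shift P a) p-prime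
                 (functional⇒unique (shift P a) J d m≤ℓ functional) ‖shiftPa‖<p x-unit
                 (p∣radoEq⇒p∣partPoly p (shift P a) J d m≤ℓ (proj₁ functional) (x 0) (x-root 0))
  in  a , a-root , J fzero , functional⇒minimalRadoSet (shift P a) J d m≤ℓ functional , primes ,
      homogeneous⇒coeffSum≡0 (shift P a) (J fzero) primes
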